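{- Let $r\geq 3$ and let $G$ be a graph on $n$ vertices with $k_r>0$. Suppose $\mathcal A\subseteq\mathcal K_r$ is well-distributed. Then for each edge $e\in E(G)$ there exists a function $\psi_e:\mathcal A\to\mathbb R$ such that: (i) for all $e,f\in E(G)$, $\sum_{K\in\mathcal A:\, f\in E(K)}\psi_e(K)=1$ if $e=f$ and $=0$ otherwise; (ii) for all $K\in\mathcal A$ and $e\in E(G)$, if $i=|V(K)\cap V(e)|$ then $|\psi_e(K)|\leq \frac{6n^i}{r^ik_r}$.
   Context: $\mathcal K_r$ denotes the set of cliques on $r$ vertices (copies of $K_r$) in $G$ and $k_r=|\mathcal K_r|$. A set $\mathcal A\subseteq\mathcal K_r$ is well-distributed if for each edge $e\in E(G)$ there are at least $k_r/2$ sets $A\subseteq V(G)\setminus V(e)$ with $|A|=r$ such that for every $B\subseteq V(e)\cup A$ with $|B|=r$, the induced subgraph $G[B]$ is a clique belonging to $\mathcal A$. -}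

module Defs where

open import Data.Bool using (Bool; true; false; not; _∧_; _∨_; if_then_else_)
open import Data.Nat using (ℕ; zero; suc; _≡ᵇ_)
open import Data.Fin using (Fin)
open import Data.Fin.Subset using (Subset; inside; outside; _∈_; ∣_∣)
open import Data.Fin.Subset.Properties using (_⊆?_; _∈?_)
open import Data.Fin.Properties using () renaming (_≟_ to _≟ᶠ_)
open import Data.List using (List; []; _∷_; _++_; map; length; filterᵇ; allFin; foldr)
open import Data.Vec using (Vec; []; _∷_; lookup)
open import Data.Integer using (+_)
open import Data.Rational using (ℚ; _/_; 0ℚ; _+_)
open import Relation.Nullary.Decidable using (⌊_⌋)
open import Relation.Binary.PropositionalEquality using (_≡_)
open import Data.Product using (_×_)

record Graph (n : ℕ) : Set where
  field
    adj    : Fin n → Fin n → Bool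
    sym    : ∀ x y → adj x y ≡ adj y x
    irrefl : ∀ x → adj x x ≡ false
open Graph public

allᵇ : ∀ {A : Set} → (A → Bool) → List A → Bool
allᵇ P = foldr (λ x acc → P x ∧ acc) true

_⊆ᵇ_ : ∀ {n} → Subset n → Subset n → Bool
p ⊆ᵇ q = ⌊ p ⊆? q ⌋

allSubsets : (n : ℕ) → List (Subset n)
allSubsets zero = [] ∷ []
allSubsets (suc n) = map (inside ∷_) (allSubsets n) ++ map (outside ∷_) (allSubsets n)

count : ∀ {n} → (Subset n → Bool) → ℕ
count {n} P = length (filterᵇ P (allSubsets n))

isCliqueᵇ : ∀ {n} → Graph n → Subset n → Bool
isCliqueᵇ {n} G S =
  allᵇ (λ x → allᵇ (λ y → not (⌊ x ∈? S ⌋ ∧ ⌊ y ∈? S ⌋) ∨ ⌊ x ≟ᶠ y ⌋ ∨ adj G x y) (allFin n)) (allFin n)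

isKrᵇ : ∀ {n} → Graph n → ℕ → Subset n → Bool
isKrᵇ G r S = isCliqueᵇ G S ∧ (∣ S ∣ ≡ᵇ r)

kr : ∀ {n} → Graph n → ℕ → ℕ
kr G r = count (isKrᵇ G r)

-- e ∈ E(G), an edge represented by its 2-element vertex set V(e).
IsEdge : ∀ {n} → Graph n → Subset n → Set
IsEdge G e = isKrᵇ G 2 e ≡ true

SubFamily : ∀ {n} → Graph n → ℕ → (Subset n → Bool) → Set
SubFamily G r 𝒜 = ∀ S → 𝒜 S ≡ true → isKrᵇ G r S ≡ true

goodSetᵇ : ∀ {n} → ℕ → (Subset n → Bool) → Subset n → Subset n → Bool
goodSetᵇ {n} r 𝒜 e A =
  (A ⊆ᵇ Data.Fin.Subset.∁ e) ∧ (∣ A ∣ ≡ᵇ r) ∧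
  allᵇ (λ B → not ((B ⊆ᵇ (e Data.Fin.Subset.∪ A)) ∧ (∣ B ∣ ≡ᵇ r)) ∨ 𝒜 B) (allSubsets n)

-- Well-distributed: for each edge e, at least k_r/2 such sets A  (i.e. 2·#A ≥ k_r).
WellDistributed : ∀ {n} → Graph n → ℕ → (Subset n → Bool) → Set
WellDistributed G r 𝒜 = ∀ e → IsEdge G e → kr G r Data.Nat.≤ 2 Data.Nat.* count (goodSetᵇ r 𝒜 e)

ℕtoℚ : ℕ → ℚ
ℕtoℚ m = + m / 1

-- Σ_{K ∈ 𝒜, f ∈ E(K)} φ(K)   (f ∈ E(K) iff V(f) ⊆ V(K), since K is a clique)
sumOverEdgeCliques : ∀ {n} → (Subset n → Bool) → Subset n → (Subset n → ℚ) → ℚ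
sumOverEdgeCliques {n} 𝒜 f φ = foldr (λ K acc → φ K + acc) 0ℚ (filterᵇ (λ K → 𝒜 K ∧ (f ⊆ᵇ K)) (allSubsets n))

module Submission where

-- Fix an edge e and a good set A for it: A is disjoint from e, ∣ A ∣ = r, and every r-subset of
-- W = e ∪ A lies in 𝒜. Give each r-subset K of W the weight w(i), i = ∣ K ∩ e ∣, where
-- (w 0, w 1, w 2) = ((r - 1)(r - 2), -(r - 2), 2). For an edge f ⊆ W the total weight of the K ⊇ f
-- depends only on ∣ f ∩ e ∣ and is a sum of binomial coefficients; it equals r (r - 1) when f = e and
-- vanishes otherwise. Averaging over the N_e good sets A and dividing by r (r - 1) gives ψ_e, and
-- (i) follows by exchanging the sums over K and A. For (ii), a clique K meeting e in i points lies in
-- e ∪ A for at most (n choose i) sets A, and N_e ≥ k_r / 2.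

open import Defs hiding (sym)

open import Algebra.Bundles using (CommutativeMonoid)
open import Data.Bool using (Bool; true; false; not; _∧_; _∨_; if_then_else_)
open import Data.Bool.Properties using (∧-zeroʳ; ∧-identityʳ; ∧-conicalˡ; ∧-conicalʳ; T-≡)
open import Data.Empty using (⊥-elim)
open import Data.Fin.Subset using (Subset; inside; outside; _∩_; _∪_; _─_; ∁; ⊥; ⊤) renaming (∣_∣ to ∣_∣ˢ)
open import Data.Fin.Subset.Properties
  using (_⊆?_; ∩-idem; ∩-zeroˡ; ∣⊥∣≡0; p─⊥≡p; ∣p∩q∣≤∣p∣; ∣p∩q∣≤∣q∣; ∣p∣≤n)
import Data.Integer as ℤ
import Data.Integer.Properties as ℤP
open import Data.List as L using (List; []; _∷_; _++_; map; length; filterᵇ; foldr)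
open import Data.List.Membership.Propositional using (_∈_)
open import Data.List.Membership.Propositional.Properties using (∈-++⁺ˡ; ∈-++⁺ʳ; ∈-map⁺)
open import Data.List.Relation.Unary.Any using (here; there)
open import Data.Nat as ℕ using (ℕ; zero; suc; _≡ᵇ_)
open import Data.Nat.Coprimality using (1-coprimeTo) renaming (sym to coprime-sym)
import Data.Nat.Properties as ℕP
open import Data.Nat.Tactic.RingSolver using (solve; solve-∀)
open import Data.Product using (Σ; _×_; _,_)
open import Data.Rational using (ℚ; 0ℚ; 1ℚ; mkℚ; _+_; _*_; _/_; _≤_; -_; 1/_; nonNegative) renaming (∣_∣ to abs)
open import Data.Rational.Properties
open import Data.Vec using ([]; _∷_)
open import Function.Bundles using (Equivalence)
open import Relation.Binary.PropositionalEquality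
open import Relation.Nullary.Decidable using (⌊⌋-map′)

open import Algebra.Properties.CommutativeSemigroup
  (CommutativeMonoid.commutativeSemigroup +-0-commutativeMonoid) using (interchange)
open import Algebra.Properties.CommutativeSemigroup
  (CommutativeMonoid.commutativeSemigroup *-1-commutativeMonoid) using (xy∙z≈xz∙y)

sumℚ : ∀ {X : Set} → (X → ℚ) → List X → ℚ
sumℚ F []       = 0ℚ
sumℚ F (x ∷ xs) = F x + sumℚ F xs

sumℚ-++ : ∀ {X : Set} (F : X → ℚ) xs ys → sumℚ F (xs ++ ys) ≡ sumℚ F xs + sumℚ F ys
sumℚ-++ F []       ys = sym (+-identityˡ _)
sumℚ-++ F (x ∷ xs) ys = trans (cong (F x +_) (sumℚ-++ F xs ys)) (sym (+-assoc (F x) _ _))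

sumℚ-map : ∀ {X Y : Set} (F : Y → ℚ) (g : X → Y) xs → sumℚ F (map g xs) ≡ sumℚ (λ x → F (g x)) xs
sumℚ-map F g []       = refl
sumℚ-map F g (x ∷ xs) = cong (F (g x) +_) (sumℚ-map F g xs)

sumℚ-cong : ∀ {X : Set} {F G : X → ℚ} xs → (∀ x → F x ≡ G x) → sumℚ F xs ≡ sumℚ G xs
sumℚ-cong []       F≗G = refl
sumℚ-cong (x ∷ xs) F≗G = cong₂ _+_ (F≗G x) (sumℚ-cong xs F≗G)

sumℚ-zero : ∀ {X : Set} (xs : List X) → sumℚ (λ _ → 0ℚ) xs ≡ 0ℚ
sumℚ-zero []       = refl
sumℚ-zero (x ∷ xs) = trans (+-identityˡ _) (sumℚ-zero xs)

sumℚ-distrib-+ : ∀ {X : Set} (F G : X → ℚ) xs → sumℚ (λ x → F x + G x) xs ≡ sumℚ F xs + sumℚ G xs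
sumℚ-distrib-+ F G []       = sym (+-identityˡ 0ℚ)
sumℚ-distrib-+ F G (x ∷ xs) = trans (cong ((F x + G x) +_) (sumℚ-distrib-+ F G xs))
  (interchange (F x) (G x) (sumℚ F xs) (sumℚ G xs))

sumℚ-*ʳ : ∀ {X : Set} (F : X → ℚ) c xs → sumℚ (λ x → F x * c) xs ≡ sumℚ F xs * c
sumℚ-*ʳ F c []       = sym (*-zeroˡ c)
sumℚ-*ʳ F c (x ∷ xs) = trans (cong (F x * c +_) (sumℚ-*ʳ F c xs)) (sym (*-distribʳ-+ c (F x) _))

sumℚ-comm : ∀ {X Y : Set} (F : X → Y → ℚ) xs ys →
  sumℚ (λ x → sumℚ (F x) ys) xs ≡ sumℚ (λ y → sumℚ (λ x → F x y) xs) ys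
sumℚ-comm F []       ys = sym (sumℚ-zero ys)
sumℚ-comm F (x ∷ xs) ys = trans (cong (sumℚ (F x) ys +_) (sumℚ-comm F xs ys))
  (sym (sumℚ-distrib-+ (F x) (λ y → sumℚ (λ x → F x y) xs) ys))

∣sumℚ∣≤sumℚ∣∣ : ∀ {X : Set} (F : X → ℚ) xs → abs (sumℚ F xs) ≤ sumℚ (λ x → abs (F x)) xs
∣sumℚ∣≤sumℚ∣∣ F []       = ≤-refl
∣sumℚ∣≤sumℚ∣∣ F (x ∷ xs) = ≤-trans (∣p+q∣≤∣p∣+∣q∣ (F x) _) (+-monoʳ-≤ (abs (F x)) (∣sumℚ∣≤sumℚ∣∣ F xs))

sumℚ-mono-≤ : ∀ {X : Set} {F G : X → ℚ} xs → (∀ x → F x ≤ G x) → sumℚ F xs ≤ sumℚ G xs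
sumℚ-mono-≤ []       F≤G = ≤-refl
sumℚ-mono-≤ (x ∷ xs) F≤G = +-mono-≤ (F≤G x) (sumℚ-mono-≤ xs F≤G)

foldr-filterᵇ≡sumℚ : ∀ {X : Set} (P : X → Bool) (F : X → ℚ) xs →
  foldr (λ x acc → F x + acc) 0ℚ (filterᵇ P xs) ≡ sumℚ (λ x → if P x then F x else 0ℚ) xs
foldr-filterᵇ≡sumℚ P F [] = refl
foldr-filterᵇ≡sumℚ P F (x ∷ xs) with P x
... | true  = cong (F x +_) (foldr-filterᵇ≡sumℚ P F xs)
... | false = trans (foldr-filterᵇ≡sumℚ P F xs) (sym (+-identityˡ _))

ℕtoℚ≡mkℚ : ∀ m → ℕtoℚ m ≡ mkℚ (ℤ.+ m) 0 (coprime-sym (1-coprimeTo m))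
ℕtoℚ≡mkℚ m = normalize-coprime (coprime-sym (1-coprimeTo m))

ℕtoℚ-suc : ∀ m → ℕtoℚ (suc m) ≡ 1ℚ + ℕtoℚ m
ℕtoℚ-suc m = begin
  ℕtoℚ (suc m)
    ≡⟨ cong (λ k → (ℤ.+ 1 ℤ.+ k) / 1) (ℤP.*-identityʳ (ℤ.+ m)) ⟨
  1ℚ + mkℚ (ℤ.+ m) 0 (coprime-sym (1-coprimeTo m))
    ≡⟨ cong (1ℚ +_) (ℕtoℚ≡mkℚ m) ⟨
  1ℚ + ℕtoℚ m ∎
  where open ≡-Reasoning

ℕtoℚ-+ : ∀ a b → ℕtoℚ (a ℕ.+ b) ≡ ℕtoℚ a + ℕtoℚ b
ℕtoℚ-+ zero    b = sym (+-identityˡ _)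
ℕtoℚ-+ (suc a) b = begin
  ℕtoℚ (suc (a ℕ.+ b))        ≡⟨ trans (ℕtoℚ-suc (a ℕ.+ b)) (cong (1ℚ +_) (ℕtoℚ-+ a b)) ⟩
  1ℚ + (ℕtoℚ a + ℕtoℚ b)       ≡⟨ +-assoc 1ℚ (ℕtoℚ a) (ℕtoℚ b) ⟨
  (1ℚ + ℕtoℚ a) + ℕtoℚ b       ≡⟨ cong (_+ ℕtoℚ b) (ℕtoℚ-suc a) ⟨
  ℕtoℚ (suc a) + ℕtoℚ b        ∎
  where open ≡-Reasoning

ℕtoℚ-* : ∀ a b → ℕtoℚ (a ℕ.* b) ≡ ℕtoℚ a * ℕtoℚ b
ℕtoℚ-* zero    b = sym (*-zeroˡ (ℕtoℚ b))
ℕtoℚ-* (suc a) b = begin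
  ℕtoℚ (b ℕ.+ a ℕ.* b)       ≡⟨ ℕtoℚ-+ b (a ℕ.* b) ⟩
  ℕtoℚ b + ℕtoℚ (a ℕ.* b)     ≡⟨ cong₂ _+_ (sym (*-identityˡ (ℕtoℚ b))) (ℕtoℚ-* a b) ⟩
  1ℚ * ℕtoℚ b + ℕtoℚ a * ℕtoℚ b ≡⟨ *-distribʳ-+ (ℕtoℚ b) 1ℚ (ℕtoℚ a) ⟨
  (1ℚ + ℕtoℚ a) * ℕtoℚ b      ≡⟨ cong (_* ℕtoℚ b) (ℕtoℚ-suc a) ⟨
  ℕtoℚ (suc a) * ℕtoℚ b       ∎
  where open ≡-Reasoning

ℕtoℚ-*-neg : ∀ a b → ℕtoℚ a * - ℕtoℚ b ≡ - ℕtoℚ (a ℕ.* b)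
ℕtoℚ-*-neg a b = trans (sym (neg-distribʳ-* (ℕtoℚ a) (ℕtoℚ b))) (cong -_ (sym (ℕtoℚ-* a b)))

0≤ℕtoℚ : ∀ m → 0ℚ ≤ ℕtoℚ m
0≤ℕtoℚ zero    = ≤-refl
0≤ℕtoℚ (suc m) = subst₂ _≤_ (+-identityˡ 0ℚ) (sym (ℕtoℚ-suc m)) (+-mono-≤ (nonNegative⁻¹ 1ℚ) (0≤ℕtoℚ m))

ℕtoℚ-mono-≤ : ∀ {a b} → a ℕ.≤ b → ℕtoℚ a ≤ ℕtoℚ b
ℕtoℚ-mono-≤ {a} {b} a≤b = begin
  ℕtoℚ a                  ≡⟨ +-identityʳ (ℕtoℚ a) ⟨
  ℕtoℚ a + 0ℚ             ≤⟨ +-monoʳ-≤ (ℕtoℚ a) (0≤ℕtoℚ (b ℕ.∸ a)) ⟩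
  ℕtoℚ a + ℕtoℚ (b ℕ.∸ a)  ≡⟨ ℕtoℚ-+ a (b ℕ.∸ a) ⟨
  ℕtoℚ (a ℕ.+ (b ℕ.∸ a))  ≡⟨ cong ℕtoℚ (ℕP.m+[n∸m]≡n a≤b) ⟩
  ℕtoℚ b                  ∎
  where open ≤-Reasoning

-- The reciprocal of a natural number, with the junk value 0 at 0.
invℕ : ℕ → ℚ
invℕ zero    = 0ℚ
invℕ (suc m) = 1/ mkℚ (ℤ.+ suc m) 0 (coprime-sym (1-coprimeTo (suc m)))

ℕtoℚ*invℕ : ∀ m .{{_ : ℕ.NonZero m}} → ℕtoℚ m * invℕ m ≡ 1ℚ
ℕtoℚ*invℕ (suc m) = trans (cong (_* invℕ (suc m)) (ℕtoℚ≡mkℚ (suc m)))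
  (*-inverseʳ (mkℚ (ℤ.+ suc m) 0 (coprime-sym (1-coprimeTo (suc m)))))

0≤invℕ : ∀ m → 0ℚ ≤ invℕ m
0≤invℕ zero    = ≤-refl
0≤invℕ (suc m) = nonNegative⁻¹ (invℕ (suc m))

if-true : ∀ {b : Bool} {x : ℚ} → b ≡ true → (if b then x else 0ℚ) ≡ x
if-true refl = refl

if-false : ∀ {b : Bool} {x : ℚ} → b ≡ false → (if b then x else 0ℚ) ≡ 0ℚ
if-false refl = refl

if-same : ∀ b → (if b then 0ℚ else 0ℚ) ≡ 0ℚ
if-same true  = refl
if-same false = refl

if-+ : ∀ b x y → (if b then x else 0ℚ) + (if b then y else 0ℚ) ≡ (if b then x + y else 0ℚ)
if-+ true  x y = refl
if-+ false x y = +-identityˡ 0ℚ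

if-* : ∀ b x c → (if b then x * c else 0ℚ) ≡ (if b then x else 0ℚ) * c
if-* true  x c = refl
if-* false x c = sym (*-zeroˡ c)

if-if : ∀ a b x → (if a then (if b then x else 0ℚ) else 0ℚ) ≡ (if b then (if a then x else 0ℚ) else 0ℚ)
if-if true  b     x = refl
if-if false true  x = refl
if-if false false x = refl

if-cong : ∀ b {x y} → (b ≡ true → x ≡ y) → (if b then x else 0ℚ) ≡ (if b then y else 0ℚ)
if-cong true  x≡y = x≡y refl
if-cong false x≡y = refl

if-∧-implied : ∀ a b c d (x : ℚ) → (c ≡ true → d ≡ true → a ≡ true) →
  (if a ∧ b then (if c then (if d then x else 0ℚ) else 0ℚ) else 0ℚ) ≡ (if b ∧ c then (if d then x else 0ℚ) else 0ℚ)
if-∧-implied true  true  c     d     x _   = refl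
if-∧-implied true  false c     d     x _   = refl
if-∧-implied false false c     d     x _   = refl
if-∧-implied false true  false d     x _   = refl
if-∧-implied false true  true  false x _   = refl
if-∧-implied false true  true  true  x c⇒a with () ← c⇒a refl refl

∣if∣≤if∣∣ : ∀ a b c d (x : ℚ) → (a ≡ true → d ≡ true) →
  abs (if a then (if b then (if c then x else 0ℚ) else 0ℚ) else 0ℚ) ≤ (if b then (if d then abs x else 0ℚ) else 0ℚ)
∣if∣≤if∣∣ false b     c     d     x _   = 0≤if b d
  where
  0≤if : ∀ b d → 0ℚ ≤ (if b then (if d then abs x else 0ℚ) else 0ℚ)
  0≤if true  true  = 0≤∣p∣ x
  0≤if true  false = ≤-refl
  0≤if false d     = ≤-refl
∣if∣≤if∣∣ true  false c     d     x _   = ≤-refl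
∣if∣≤if∣∣ true  true  false true  x _   = 0≤∣p∣ x
∣if∣≤if∣∣ true  true  true  true  x _   = ≤-refl
∣if∣≤if∣∣ true  true  c     false x a⇒d with () ← a⇒d refl

sumℚ-indicator : ∀ {X : Set} (P : X → Bool) c xs →
  sumℚ (λ x → if P x then c else 0ℚ) xs ≡ ℕtoℚ (length (filterᵇ P xs)) * c
sumℚ-indicator P c [] = sym (*-zeroˡ c)
sumℚ-indicator P c (x ∷ xs) with P x
... | true  = begin
  c + sumℚ (λ x → if P x then c else 0ℚ) xs  ≡⟨ cong (c +_) (sumℚ-indicator P c xs) ⟩
  c + ℕtoℚ ℓ * c                             ≡⟨ cong (_+ ℕtoℚ ℓ * c) (*-identityˡ c) ⟨
  1ℚ * c + ℕtoℚ ℓ * c                        ≡⟨ *-distribʳ-+ c 1ℚ (ℕtoℚ ℓ) ⟨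
  (1ℚ + ℕtoℚ ℓ) * c                          ≡⟨ cong (_* c) (ℕtoℚ-suc ℓ) ⟨
  ℕtoℚ (suc ℓ) * c                           ∎
  where
  open ≡-Reasoning
  ℓ = length (filterᵇ P xs)
... | false = trans (+-identityˡ _) (sumℚ-indicator P c xs)

-- A structurally recursive _⊆ᵇ_, which computes on cons-cells.
_⊑_ : ∀ {n} → Subset n → Subset n → Bool
[]      ⊑ []      = true
(x ∷ p) ⊑ (y ∷ q) = (not x ∨ y) ∧ (p ⊑ q)

⊆ᵇ≡⊑ : ∀ {n} (p q : Subset n) → p ⊆ᵇ q ≡ p ⊑ q
⊆ᵇ≡⊑ []          []          = refl
⊆ᵇ≡⊑ (false ∷ p) (y ∷ q)     = trans (⌊⌋-map′ _ _ (p ⊆? q)) (⊆ᵇ≡⊑ p q)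
⊆ᵇ≡⊑ (true ∷ p)  (false ∷ q) = refl
⊆ᵇ≡⊑ (true ∷ p)  (true ∷ q)  = trans (⌊⌋-map′ _ _ (p ⊆? q)) (⊆ᵇ≡⊑ p q)

⊑⊤ : ∀ {n} (p : Subset n) → p ⊑ ⊤ ≡ true
⊑⊤ []          = refl
⊑⊤ (true ∷ p)  = ⊑⊤ p
⊑⊤ (false ∷ p) = ⊑⊤ p

⊑∪ : ∀ {n} (p q : Subset n) → p ⊑ (p ∪ q) ≡ true
⊑∪ []          []      = refl
⊑∪ (true ∷ p)  (b ∷ q) = ⊑∪ p q
⊑∪ (false ∷ p) (b ∷ q) = ⊑∪ p q

⊑∪≡─⊑ : ∀ {n} (K e A : Subset n) → K ⊑ (e ∪ A) ≡ (K ─ e) ⊑ A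
⊑∪≡─⊑ []          []          []      = refl
⊑∪≡─⊑ (false ∷ K) (true ∷ e)  (b ∷ A) = ⊑∪≡─⊑ K e A
⊑∪≡─⊑ (false ∷ K) (false ∷ e) (b ∷ A) = ⊑∪≡─⊑ K e A
⊑∪≡─⊑ (true ∷ K)  (true ∷ e)  (b ∷ A) = ⊑∪≡─⊑ K e A
⊑∪≡─⊑ (true ∷ K)  (false ∷ e) (b ∷ A) = cong (b ∧_) (⊑∪≡─⊑ K e A)

allᵇ-∈ : ∀ {X : Set} (P : X → Bool) {x xs} → allᵇ P xs ≡ true → x ∈ xs → P x ≡ true
allᵇ-∈ P {xs = y ∷ ys} all≡true (here refl)  = ∧-conicalˡ (P y) _ all≡true
allᵇ-∈ P {xs = y ∷ ys} all≡true (there x∈ys) = allᵇ-∈ P (∧-conicalʳ (P y) _ all≡true) x∈ys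

∈-allSubsets : ∀ {n} (K : Subset n) → K ∈ allSubsets n
∈-allSubsets []          = here refl
∈-allSubsets (true ∷ K)  = ∈-++⁺ˡ (∈-map⁺ (inside ∷_) (∈-allSubsets K))
∈-allSubsets (false ∷ K) = ∈-++⁺ʳ _ (∈-map⁺ (outside ∷_) (∈-allSubsets K))

∣p─q∣+∣p∩q∣≡∣p∣ : ∀ {n} (p q : Subset n) → ∣ p ─ q ∣ˢ ℕ.+ ∣ p ∩ q ∣ˢ ≡ ∣ p ∣ˢ
∣p─q∣+∣p∩q∣≡∣p∣ []          []          = refl
∣p─q∣+∣p∩q∣≡∣p∣ (false ∷ p) (true ∷ q)  = ∣p─q∣+∣p∩q∣≡∣p∣ p q
∣p─q∣+∣p∩q∣≡∣p∣ (false ∷ p) (false ∷ q) = ∣p─q∣+∣p∩q∣≡∣p∣ p q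
∣p─q∣+∣p∩q∣≡∣p∣ (true ∷ p)  (true ∷ q)  = trans (ℕP.+-suc _ _) (cong suc (∣p─q∣+∣p∩q∣≡∣p∣ p q))
∣p─q∣+∣p∩q∣≡∣p∣ (true ∷ p)  (false ∷ q) = cong suc (∣p─q∣+∣p∩q∣≡∣p∣ p q)

∣p∩q∣+∣p─q∣≡∣p∣ : ∀ {n} (p q : Subset n) → ∣ p ∩ q ∣ˢ ℕ.+ ∣ p ─ q ∣ˢ ≡ ∣ p ∣ˢ
∣p∩q∣+∣p─q∣≡∣p∣ p q = trans (ℕP.+-comm ∣ p ∩ q ∣ˢ _) (∣p─q∣+∣p∩q∣≡∣p∣ p q)

∣p∩[p∪q]─r∣+∣r∩p∣≡∣p∣ : ∀ {n} (p q r : Subset n) → ∣ p ∩ ((p ∪ q) ─ r) ∣ˢ ℕ.+ ∣ r ∩ p ∣ˢ ≡ ∣ p ∣ˢ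
∣p∩[p∪q]─r∣+∣r∩p∣≡∣p∣ []          []      []          = refl
∣p∩[p∪q]─r∣+∣r∩p∣≡∣p∣ (true ∷ p)  (b ∷ q) (true ∷ r)  =
  trans (ℕP.+-suc _ _) (cong suc (∣p∩[p∪q]─r∣+∣r∩p∣≡∣p∣ p q r))
∣p∩[p∪q]─r∣+∣r∩p∣≡∣p∣ (true ∷ p)  (b ∷ q) (false ∷ r) = cong suc (∣p∩[p∪q]─r∣+∣r∩p∣≡∣p∣ p q r)
∣p∩[p∪q]─r∣+∣r∩p∣≡∣p∣ (false ∷ p) (b ∷ q) (true ∷ r)  = ∣p∩[p∪q]─r∣+∣r∩p∣≡∣p∣ p q r
∣p∩[p∪q]─r∣+∣r∩p∣≡∣p∣ (false ∷ p) (b ∷ q) (false ∷ r) = ∣p∩[p∪q]─r∣+∣r∩p∣≡∣p∣ p q r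

∣[p∪q]─r─p∣+∣r─p∣≡∣q∣ : ∀ {n} (p q r : Subset n) → q ⊑ ∁ p ≡ true → r ⊑ (p ∪ q) ≡ true →
  ∣ (p ∪ q) ─ r ─ p ∣ˢ ℕ.+ ∣ r ─ p ∣ˢ ≡ ∣ q ∣ˢ
∣[p∪q]─r─p∣+∣r─p∣≡∣q∣ []          []          []          _    _    = refl
∣[p∪q]─r─p∣+∣r─p∣≡∣q∣ (true ∷ p)  (false ∷ q) (true ∷ r)  disj incl = ∣[p∪q]─r─p∣+∣r─p∣≡∣q∣ p q r disj incl
∣[p∪q]─r─p∣+∣r─p∣≡∣q∣ (true ∷ p)  (false ∷ q) (false ∷ r) disj incl = ∣[p∪q]─r─p∣+∣r─p∣≡∣q∣ p q r disj incl
∣[p∪q]─r─p∣+∣r─p∣≡∣q∣ (false ∷ p) (false ∷ q) (false ∷ r) disj incl = ∣[p∪q]─r─p∣+∣r─p∣≡∣q∣ p q r disj incl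
∣[p∪q]─r─p∣+∣r─p∣≡∣q∣ (false ∷ p) (true ∷ q)  (true ∷ r)  disj incl =
  trans (ℕP.+-suc _ _) (cong suc (∣[p∪q]─r─p∣+∣r─p∣≡∣q∣ p q r disj incl))
∣[p∪q]─r─p∣+∣r─p∣≡∣q∣ (false ∷ p) (true ∷ q)  (false ∷ r) disj incl =
  cong suc (∣[p∪q]─r─p∣+∣r─p∣≡∣q∣ p q r disj incl)
∣[p∪q]─r─p∣+∣r─p∣≡∣q∣ (true ∷ p)  (true ∷ q)  (c ∷ r)     ()   _
∣[p∪q]─r─p∣+∣r─p∣≡∣q∣ (false ∷ p) (false ∷ q) (true ∷ r)  _    ()

∣p∩q∣≡∣p∣≡∣q∣⇒p≡q : ∀ {n} (p q : Subset n) → ∣ p ∩ q ∣ˢ ≡ ∣ p ∣ˢ → ∣ p ∩ q ∣ˢ ≡ ∣ q ∣ˢ → p ≡ q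
∣p∩q∣≡∣p∣≡∣q∣⇒p≡q []          []          _ _ = refl
∣p∩q∣≡∣p∣≡∣q∣⇒p≡q (true ∷ p)  (true ∷ q)  ≡p ≡q =
  cong (true ∷_) (∣p∩q∣≡∣p∣≡∣q∣⇒p≡q p q (ℕP.suc-injective ≡p) (ℕP.suc-injective ≡q))
∣p∩q∣≡∣p∣≡∣q∣⇒p≡q (false ∷ p) (false ∷ q) ≡p ≡q =
  cong (false ∷_) (∣p∩q∣≡∣p∣≡∣q∣⇒p≡q p q ≡p ≡q)
∣p∩q∣≡∣p∣≡∣q∣⇒p≡q (true ∷ p)  (false ∷ q) ≡p _  = ⊥-elim (ℕP.<-irrefl ≡p (ℕ.s≤s (∣p∩q∣≤∣p∣ p q)))
∣p∩q∣≡∣p∣≡∣q∣⇒p≡q (false ∷ p) (true ∷ q)  _  ≡q = ⊥-elim (ℕP.<-irrefl ≡q (ℕ.s≤s (∣p∩q∣≤∣q∣ p q)))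

∑ˢ : ∀ {n} → (Subset n → ℚ) → ℚ
∑ˢ {n} F = sumℚ F (allSubsets n)

∑ˢ-∷ : ∀ {n} (F : Subset (suc n) → ℚ) → ∑ˢ F ≡ ∑ˢ (λ K → F (inside ∷ K)) + ∑ˢ (λ K → F (outside ∷ K))
∑ˢ-∷ {n} F = trans (sumℚ-++ F (map (inside ∷_) (allSubsets n)) _)
  (cong₂ _+_ (sumℚ-map F (inside ∷_) (allSubsets n)) (sumℚ-map F (outside ∷_) (allSubsets n)))

∑ˢ-cong : ∀ {n} {F G : Subset n → ℚ} → (∀ K → F K ≡ G K) → ∑ˢ F ≡ ∑ˢ G
∑ˢ-cong {n} = sumℚ-cong (allSubsets n)

∑ˢ-zero : ∀ n → ∑ˢ {n} (λ _ → 0ℚ) ≡ 0ℚ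
∑ˢ-zero n = sumℚ-zero (allSubsets n)

∑ˢ-vanish : ∀ {n} {F : Subset n → ℚ} → (∀ K → F K ≡ 0ℚ) → ∑ˢ F ≡ 0ℚ
∑ˢ-vanish {n} F≗0 = trans (∑ˢ-cong F≗0) (∑ˢ-zero n)

if-∑ˢ : ∀ {n} b (F : Subset n → ℚ) → (if b then ∑ˢ F else 0ℚ) ≡ ∑ˢ (λ A → if b then F A else 0ℚ)
if-∑ˢ     true  F = refl
if-∑ˢ {n} false F = sym (∑ˢ-zero n)

∑ˢ-double-count : ∀ {n} (P Q : Subset n → Bool) (F : Subset n → Subset n → ℚ) V →
  (∀ A → Q A ≡ true → ∑ˢ (λ K → if P K then F A K else 0ℚ) ≡ V) →
  ∑ˢ (λ K → if P K then ∑ˢ (λ A → if Q A then F A K else 0ℚ) else 0ℚ) ≡ ℕtoℚ (count Q) * V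
∑ˢ-double-count {n} P Q F V ∑F≡V = begin
  ∑ˢ (λ K → if P K then ∑ˢ (λ A → if Q A then F A K else 0ℚ) else 0ℚ)
    ≡⟨ ∑ˢ-cong (λ K → if-∑ˢ {n} (P K) _) ⟩
  ∑ˢ (λ K → ∑ˢ (λ A → if P K then (if Q A then F A K else 0ℚ) else 0ℚ))
    ≡⟨ sumℚ-comm _ (allSubsets n) (allSubsets n) ⟩
  ∑ˢ (λ A → ∑ˢ (λ K → if P K then (if Q A then F A K else 0ℚ) else 0ℚ))
    ≡⟨ ∑ˢ-cong (λ A → trans (∑ˢ-cong (λ K → if-if (P K) (Q A) _)) (sym (if-∑ˢ {n} (Q A) _))) ⟩
  ∑ˢ (λ A → if Q A then ∑ˢ (λ K → if P K then F A K else 0ℚ) else 0ℚ)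
    ≡⟨ ∑ˢ-cong (λ A → if-cong (Q A) (∑F≡V A)) ⟩
  ∑ˢ (λ A → if Q A then V else 0ℚ)
    ≡⟨ sumℚ-indicator Q V (allSubsets n) ⟩
  ℕtoℚ (count Q) * V ∎
  where open ≡-Reasoning

-- Binomial coefficients and binomial sums

+-≡ᵇ-cancelˡ : ∀ m s j → (m ℕ.+ s ≡ᵇ m ℕ.+ j) ≡ (s ≡ᵇ j)
+-≡ᵇ-cancelˡ zero    s j = refl
+-≡ᵇ-cancelˡ (suc m) s j = +-≡ᵇ-cancelˡ m s j

choose : ℕ → ℕ → ℕ
choose _       zero    = 1
choose zero    (suc j) = 0
choose (suc m) (suc j) = choose m (suc j) ℕ.+ choose m j

choose-< : ∀ m j → m ℕ.< j → choose m j ≡ 0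
choose-< zero    (suc j) _          = refl
choose-< (suc m) (suc j) (ℕ.s≤s m<j) = cong₂ ℕ._+_ (choose-< m (suc j) (ℕP.m≤n⇒m≤1+n m<j)) (choose-< m j m<j)

choose-diag : ∀ m → choose m m ≡ 1
choose-diag zero    = refl
choose-diag (suc m) = cong₂ ℕ._+_ (choose-< m (suc m) ℕP.≤-refl) (choose-diag m)

choose-suc-diag : ∀ m → choose (suc m) m ≡ suc m
choose-suc-diag zero    = refl
choose-suc-diag (suc m) = cong₂ ℕ._+_ (choose-diag (suc m)) (choose-suc-diag m)

choose-1 : ∀ m → choose m 1 ≡ m
choose-1 zero    = refl
choose-1 (suc m) = trans (cong (ℕ._+ 1) (choose-1 m)) (ℕP.+-comm m 1)

choose-2 : ∀ m → choose (2 ℕ.+ m) m ℕ.* 2 ≡ (2 ℕ.+ m) ℕ.* (1 ℕ.+ m)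
choose-2 zero    = refl
choose-2 (suc m) = begin
  (choose (2 ℕ.+ m) (suc m) ℕ.+ choose (2 ℕ.+ m) m) ℕ.* 2
    ≡⟨ ℕP.*-distribʳ-+ 2 (choose (2 ℕ.+ m) (suc m)) _ ⟩
  choose (2 ℕ.+ m) (suc m) ℕ.* 2 ℕ.+ choose (2 ℕ.+ m) m ℕ.* 2
    ≡⟨ cong₂ (λ a b → a ℕ.* 2 ℕ.+ b) (choose-suc-diag (suc m)) (choose-2 m) ⟩
  (2 ℕ.+ m) ℕ.* 2 ℕ.+ (2 ℕ.+ m) ℕ.* (1 ℕ.+ m)
    ≡⟨ solve (m L.∷ L.[]) ⟩
  (3 ℕ.+ m) ℕ.* (2 ℕ.+ m) ∎
  where open ≡-Reasoning

choose-2*2≤m² : ∀ m → choose m 2 ℕ.* 2 ℕ.≤ m ℕ.* m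
choose-2*2≤m² zero    = ℕ.z≤n
choose-2*2≤m² (suc m) = begin
  (choose m 2 ℕ.+ choose m 1) ℕ.* 2   ≡⟨ cong (λ c → (choose m 2 ℕ.+ c) ℕ.* 2) (choose-1 m) ⟩
  (choose m 2 ℕ.+ m) ℕ.* 2            ≡⟨ ℕP.*-distribʳ-+ 2 (choose m 2) m ⟩
  choose m 2 ℕ.* 2 ℕ.+ m ℕ.* 2        ≤⟨ ℕP.+-monoˡ-≤ (m ℕ.* 2) (choose-2*2≤m² m) ⟩
  m ℕ.* m ℕ.+ m ℕ.* 2                 ≤⟨ ℕP.n≤1+n _ ⟩
  suc (m ℕ.* m ℕ.+ m ℕ.* 2)           ≡⟨ solve (m L.∷ L.[]) ⟩
  suc m ℕ.* suc m                     ∎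
  where open ℕP.≤-Reasoning

-- binomialSum m h = Σₛ (m choose s) · h s
binomialSum : ℕ → (ℕ → ℚ) → ℚ
binomialSum zero    h = h 0
binomialSum (suc m) h = binomialSum m h + binomialSum m (λ s → h (suc s))

-- binomialSum₂ p q g = Σₓ Σᵧ (p choose x) (q choose y) · g x (x + y)
binomialSum₂ : ℕ → ℕ → (ℕ → ℕ → ℚ) → ℚ
binomialSum₂ zero    q g = binomialSum q (g 0)
binomialSum₂ (suc p) q g = binomialSum₂ p q g + binomialSum₂ p q (λ x s → g (suc x) (suc s))

binomialSum-cong : ∀ m {h k : ℕ → ℚ} → (∀ s → h s ≡ k s) → binomialSum m h ≡ binomialSum m k
binomialSum-cong zero    h≗k = h≗k 0
binomialSum-cong (suc m) h≗k = cong₂ _+_ (binomialSum-cong m h≗k) (binomialSum-cong m (λ s → h≗k (suc s)))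

binomialSum-zero : ∀ m → binomialSum m (λ _ → 0ℚ) ≡ 0ℚ
binomialSum-zero zero    = refl
binomialSum-zero (suc m) = trans (cong₂ _+_ (binomialSum-zero m) (binomialSum-zero m)) (+-identityˡ 0ℚ)

binomialSum-indicator : ∀ m j c → binomialSum m (λ s → if s ≡ᵇ j then c else 0ℚ) ≡ ℕtoℚ (choose m j) * c
binomialSum-indicator zero    zero    c = sym (*-identityˡ c)
binomialSum-indicator zero    (suc j) c = sym (*-zeroˡ c)
binomialSum-indicator (suc m) zero    c =
  trans (cong₂ _+_ (binomialSum-indicator m zero c) (binomialSum-zero m)) (+-identityʳ _)
binomialSum-indicator (suc m) (suc j) c = begin
  binomialSum m (δ (suc j)) + binomialSum m (δ j)
    ≡⟨ cong₂ _+_ (binomialSum-indicator m (suc j) c) (binomialSum-indicator m j c) ⟩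
  ℕtoℚ (choose m (suc j)) * c + ℕtoℚ (choose m j) * c
    ≡⟨ *-distribʳ-+ c (ℕtoℚ (choose m (suc j))) _ ⟨
  (ℕtoℚ (choose m (suc j)) + ℕtoℚ (choose m j)) * c
    ≡⟨ cong (_* c) (ℕtoℚ-+ (choose m (suc j)) (choose m j)) ⟨
  ℕtoℚ (choose (suc m) (suc j)) * c ∎
  where
  open ≡-Reasoning
  δ : ℕ → ℕ → ℚ
  δ j s = if s ≡ᵇ j then c else 0ℚ

binomialSum₂-cong : ∀ p q {g h : ℕ → ℕ → ℚ} → (∀ x s → g x s ≡ h x s) → binomialSum₂ p q g ≡ binomialSum₂ p q h
binomialSum₂-cong zero    q g≗h = binomialSum-cong q (g≗h 0)
binomialSum₂-cong (suc p) q g≗h =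
  cong₂ _+_ (binomialSum₂-cong p q g≗h) (binomialSum₂-cong p q (λ x s → g≗h (suc x) (suc s)))

binomialSum₂-sucʳ : ∀ p q g → binomialSum₂ p (suc q) g ≡ binomialSum₂ p q g + binomialSum₂ p q (λ x s → g x (suc s))
binomialSum₂-sucʳ zero    q g = refl
binomialSum₂-sucʳ (suc p) q g = trans
  (cong₂ _+_ (binomialSum₂-sucʳ p q g) (binomialSum₂-sucʳ p q (λ x s → g (suc x) (suc s))))
  (interchange (binomialSum₂ p q g) _ _ _)

-- Sums over intervals of the subset lattice

intervalTerm : ∀ {n} (e f W : Subset n) → (ℕ → ℕ → ℚ) → Subset n → ℚ
intervalTerm e f W g K = if f ⊑ K ∧ K ⊑ W then g ∣ K ∩ e ∣ˢ ∣ K ∣ˢ else 0ℚ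

intervalSum : ∀ {n} (e f W : Subset n) → (ℕ → ℕ → ℚ) → ℚ
intervalSum e f W g = ∑ˢ (intervalTerm e f W g)

-- K is f together with x points of e ∩ (W ─ f) and y points of W ─ f ─ e.
intervalSum≡binomialSum₂ : ∀ {n} (e f W : Subset n) g → intervalSum e f W g ≡
  (if f ⊑ W then binomialSum₂ ∣ e ∩ (W ─ f) ∣ˢ ∣ W ─ f ─ e ∣ˢ (λ x s → g (∣ f ∩ e ∣ˢ ℕ.+ x) (∣ f ∣ˢ ℕ.+ s)) else 0ℚ)
intervalSum≡binomialSum₂ [] [] [] g = +-identityʳ (g 0 0)
intervalSum≡binomialSum₂ {suc n} (a ∷ e) (true ∷ f) (false ∷ W) g =
  trans (∑ˢ-∷ (intervalTerm (a ∷ e) (true ∷ f) (false ∷ W) g))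
    (trans (cong₂ _+_ (∑ˢ-vanish (λ K → if-false (∧-zeroʳ (f ⊑ K)))) (∑ˢ-zero n)) (+-identityˡ 0ℚ))
intervalSum≡binomialSum₂ {suc n} (true ∷ e) (true ∷ f) (true ∷ W) g =
  trans (∑ˢ-∷ (intervalTerm (true ∷ e) (true ∷ f) (true ∷ W) g))
    (trans (cong₂ _+_ (intervalSum≡binomialSum₂ e f W (λ x s → g (suc x) (suc s))) (∑ˢ-zero n)) (+-identityʳ _))
intervalSum≡binomialSum₂ {suc n} (false ∷ e) (true ∷ f) (true ∷ W) g =
  trans (∑ˢ-∷ (intervalTerm (false ∷ e) (true ∷ f) (true ∷ W) g))
    (trans (cong₂ _+_ (intervalSum≡binomialSum₂ e f W (λ x s → g x (suc s))) (∑ˢ-zero n)) (+-identityʳ _))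
intervalSum≡binomialSum₂ {suc n} (true ∷ e) (false ∷ f) (false ∷ W) g =
  trans (∑ˢ-∷ (intervalTerm (true ∷ e) (false ∷ f) (false ∷ W) g))
    (trans (cong₂ _+_ (∑ˢ-vanish (λ K → if-false (∧-zeroʳ (f ⊑ K)))) (intervalSum≡binomialSum₂ e f W g)) (+-identityˡ _))
intervalSum≡binomialSum₂ {suc n} (false ∷ e) (false ∷ f) (false ∷ W) g =
  trans (∑ˢ-∷ (intervalTerm (false ∷ e) (false ∷ f) (false ∷ W) g))
    (trans (cong₂ _+_ (∑ˢ-vanish (λ K → if-false (∧-zeroʳ (f ⊑ K)))) (intervalSum≡binomialSum₂ e f W g)) (+-identityˡ _))
intervalSum≡binomialSum₂ {suc n} (true ∷ e) (false ∷ f) (true ∷ W) g = begin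
  intervalSum (true ∷ e) (false ∷ f) (true ∷ W) g
    ≡⟨ ∑ˢ-∷ (intervalTerm (true ∷ e) (false ∷ f) (true ∷ W) g) ⟩
  intervalSum e f W (λ x s → g (suc x) (suc s)) + intervalSum e f W g
    ≡⟨ cong₂ _+_ (intervalSum≡binomialSum₂ e f W (λ x s → g (suc x) (suc s)))
                 (intervalSum≡binomialSum₂ e f W g) ⟩
  (if f ⊑ W then binomialSum₂ P Q (λ x s → g (suc (U ℕ.+ x)) (suc (F ℕ.+ s))) else 0ℚ)
    + (if f ⊑ W then binomialSum₂ P Q h else 0ℚ)
    ≡⟨ if-+ (f ⊑ W) _ _ ⟩
  (if f ⊑ W then binomialSum₂ P Q (λ x s → g (suc (U ℕ.+ x)) (suc (F ℕ.+ s))) + binomialSum₂ P Q h else 0ℚ)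
    ≡⟨ cong (λ z → if f ⊑ W then z else 0ℚ) (trans (+-comm _ (binomialSum₂ P Q h))
         (cong (binomialSum₂ P Q h +_)
           (binomialSum₂-cong P Q (λ x s → cong₂ g (sym (ℕP.+-suc U x)) (sym (ℕP.+-suc F s)))))) ⟩
  (if f ⊑ W then binomialSum₂ (suc P) Q h else 0ℚ) ∎
  where
  open ≡-Reasoning
  P = ∣ e ∩ (W ─ f) ∣ˢ
  Q = ∣ W ─ f ─ e ∣ˢ
  U = ∣ f ∩ e ∣ˢ
  F = ∣ f ∣ˢ
  h : ℕ → ℕ → ℚ
  h x s = g (U ℕ.+ x) (F ℕ.+ s)
intervalSum≡binomialSum₂ {suc n} (false ∷ e) (false ∷ f) (true ∷ W) g = begin
  intervalSum (false ∷ e) (false ∷ f) (true ∷ W) g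
    ≡⟨ ∑ˢ-∷ (intervalTerm (false ∷ e) (false ∷ f) (true ∷ W) g) ⟩
  intervalSum e f W (λ x s → g x (suc s)) + intervalSum e f W g
    ≡⟨ cong₂ _+_ (intervalSum≡binomialSum₂ e f W (λ x s → g x (suc s)))
                 (intervalSum≡binomialSum₂ e f W g) ⟩
  (if f ⊑ W then binomialSum₂ P Q (λ x s → g (U ℕ.+ x) (suc (F ℕ.+ s))) else 0ℚ)
    + (if f ⊑ W then binomialSum₂ P Q h else 0ℚ)
    ≡⟨ if-+ (f ⊑ W) _ _ ⟩
  (if f ⊑ W then binomialSum₂ P Q (λ x s → g (U ℕ.+ x) (suc (F ℕ.+ s))) + binomialSum₂ P Q h else 0ℚ)
    ≡⟨ cong (λ z → if f ⊑ W then z else 0ℚ) (trans (+-comm _ (binomialSum₂ P Q h))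
         (trans (cong (binomialSum₂ P Q h +_)
                  (binomialSum₂-cong P Q (λ x s → cong (g (U ℕ.+ x)) (sym (ℕP.+-suc F s)))))
                (sym (binomialSum₂-sucʳ P Q h)))) ⟩
  (if f ⊑ W then binomialSum₂ P (suc Q) h else 0ℚ) ∎
  where
  open ≡-Reasoning
  P = ∣ e ∩ (W ─ f) ∣ˢ
  Q = ∣ W ─ f ─ e ∣ˢ
  U = ∣ f ∩ e ∣ˢ
  F = ∣ f ∣ˢ
  h : ℕ → ℕ → ℚ
  h x s = g (U ℕ.+ x) (F ℕ.+ s)

∑ˢ-supersets : ∀ {n} (D : Subset n) (h : ℕ → ℚ) →
  ∑ˢ (λ A → if D ⊑ A then h ∣ A ∣ˢ else 0ℚ) ≡ binomialSum ∣ ⊤ ─ D ∣ˢ (λ s → h (∣ D ∣ˢ ℕ.+ s))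
∑ˢ-supersets {n} D h = begin
  ∑ˢ (λ A → if D ⊑ A then h ∣ A ∣ˢ else 0ℚ)
    ≡⟨ ∑ˢ-cong (λ A → cong (λ b → if b then h ∣ A ∣ˢ else 0ℚ)
         (sym (trans (cong (D ⊑ A ∧_) (⊑⊤ A)) (∧-identityʳ (D ⊑ A))))) ⟩
  intervalSum ⊥ D ⊤ (λ _ s → h s)
    ≡⟨ intervalSum≡binomialSum₂ ⊥ D ⊤ (λ _ s → h s) ⟩
  (if D ⊑ ⊤ then binomialSum₂ ∣ ⊥ ∩ (⊤ ─ D) ∣ˢ ∣ ⊤ ─ D ─ ⊥ ∣ˢ (λ _ s → h (∣ D ∣ˢ ℕ.+ s)) else 0ℚ)
    ≡⟨ if-true (⊑⊤ D) ⟩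
  binomialSum₂ ∣ ⊥ ∩ (⊤ ─ D) ∣ˢ ∣ ⊤ ─ D ─ ⊥ ∣ˢ (λ _ s → h (∣ D ∣ˢ ℕ.+ s))
    ≡⟨ cong₂ (λ p q → binomialSum₂ p q (λ _ s → h (∣ D ∣ˢ ℕ.+ s)))
         (trans (cong ∣_∣ˢ (∩-zeroˡ (⊤ ─ D))) (∣⊥∣≡0 n)) (cong ∣_∣ˢ (p─⊥≡p (⊤ ─ D))) ⟩
  binomialSum ∣ ⊤ ─ D ∣ˢ (λ s → h (∣ D ∣ˢ ℕ.+ s)) ∎
  where open ≡-Reasoning

-- The weights

-- Here and below r = 3 + t, which builds in r ≥ 3.
∣weight∣ : ℕ → ℕ → ℕ
∣weight∣ t 0 = (2 ℕ.+ t) ℕ.* (1 ℕ.+ t)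
∣weight∣ t 1 = 1 ℕ.+ t
∣weight∣ t _ = 2

weight : ℕ → ℕ → ℚ
weight t 0             = ℕtoℚ (∣weight∣ t 0)
weight t 1             = - ℕtoℚ (∣weight∣ t 1)
weight t (suc (suc i)) = ℕtoℚ (∣weight∣ t (suc (suc i)))

abs-weight : ∀ t i → abs (weight t i) ≡ ℕtoℚ (∣weight∣ t i)
abs-weight t 0             = 0≤p⇒∣p∣≡p (0≤ℕtoℚ (∣weight∣ t 0))
abs-weight t 1             = trans (∣-p∣≡∣p∣ (ℕtoℚ (1 ℕ.+ t))) (0≤p⇒∣p∣≡p (0≤ℕtoℚ (1 ℕ.+ t)))
abs-weight t (suc (suc i)) = 0≤p⇒∣p∣≡p (0≤ℕtoℚ 2)

cliqueWeight : ℕ → ℕ → ℕ → ℚ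
cliqueWeight t i s = if s ≡ᵇ 3 ℕ.+ t then weight t i else 0ℚ

weightSum-equal : ∀ t →
  binomialSum₂ 0 (3 ℕ.+ t) (λ x s → cliqueWeight t (2 ℕ.+ x) (2 ℕ.+ s)) ≡ ℕtoℚ ((3 ℕ.+ t) ℕ.* (2 ℕ.+ t))
weightSum-equal t = begin
  binomialSum (3 ℕ.+ t) (λ s → if s ≡ᵇ 1 ℕ.+ t then ℕtoℚ 2 else 0ℚ)
    ≡⟨ binomialSum-indicator (3 ℕ.+ t) (1 ℕ.+ t) (ℕtoℚ 2) ⟩
  ℕtoℚ (choose (3 ℕ.+ t) (1 ℕ.+ t)) * ℕtoℚ 2
    ≡⟨ ℕtoℚ-* (choose (3 ℕ.+ t) (1 ℕ.+ t)) 2 ⟨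
  ℕtoℚ (choose (3 ℕ.+ t) (1 ℕ.+ t) ℕ.* 2)
    ≡⟨ cong ℕtoℚ (choose-2 (1 ℕ.+ t)) ⟩
  ℕtoℚ ((3 ℕ.+ t) ℕ.* (2 ℕ.+ t)) ∎
  where open ≡-Reasoning

weightSum-meeting : ∀ t → binomialSum₂ 1 (2 ℕ.+ t) (λ x s → cliqueWeight t (1 ℕ.+ x) (2 ℕ.+ s)) ≡ 0ℚ
weightSum-meeting t = begin
  binomialSum (2 ℕ.+ t) (λ s → if s ≡ᵇ 1 ℕ.+ t then - ℕtoℚ (1 ℕ.+ t) else 0ℚ)
    + binomialSum (2 ℕ.+ t) (λ s → if s ≡ᵇ t then ℕtoℚ 2 else 0ℚ)
    ≡⟨ cong₂ _+_ (binomialSum-indicator (2 ℕ.+ t) (1 ℕ.+ t) _) (binomialSum-indicator (2 ℕ.+ t) t _) ⟩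
  ℕtoℚ (choose (2 ℕ.+ t) (1 ℕ.+ t)) * - ℕtoℚ (1 ℕ.+ t) + ℕtoℚ (choose (2 ℕ.+ t) t) * ℕtoℚ 2
    ≡⟨ cong₂ _+_ (ℕtoℚ-*-neg (choose (2 ℕ.+ t) (1 ℕ.+ t)) (1 ℕ.+ t)) (sym (ℕtoℚ-* (choose (2 ℕ.+ t) t) 2)) ⟩
  - ℕtoℚ (choose (2 ℕ.+ t) (1 ℕ.+ t) ℕ.* (1 ℕ.+ t)) + ℕtoℚ (choose (2 ℕ.+ t) t ℕ.* 2)
    ≡⟨ cong₂ (λ a b → - ℕtoℚ (a ℕ.* (1 ℕ.+ t)) + ℕtoℚ b) (choose-suc-diag (1 ℕ.+ t)) (choose-2 t) ⟩
  - ℕtoℚ ((2 ℕ.+ t) ℕ.* (1 ℕ.+ t)) + ℕtoℚ ((2 ℕ.+ t) ℕ.* (1 ℕ.+ t))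
    ≡⟨ +-inverseˡ (ℕtoℚ ((2 ℕ.+ t) ℕ.* (1 ℕ.+ t))) ⟩
  0ℚ ∎
  where open ≡-Reasoning

2[2+t]²≡[3+t][2+t]+[2+t][1+t] : ∀ t →
  (2 ℕ.+ t) ℕ.* (2 ℕ.+ t) ℕ.+ (2 ℕ.+ t) ℕ.* (2 ℕ.+ t) ≡ (3 ℕ.+ t) ℕ.* (2 ℕ.+ t) ℕ.+ (2 ℕ.+ t) ℕ.* (1 ℕ.+ t)
2[2+t]²≡[3+t][2+t]+[2+t][1+t] = solve-∀

weightSum-disjoint : ∀ t → binomialSum₂ 2 (1 ℕ.+ t) (λ x s → cliqueWeight t x (2 ℕ.+ s)) ≡ 0ℚ
weightSum-disjoint zero    = refl
weightSum-disjoint (suc t) = begin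
  (T₀ + T₁) + (T₁ + T₂)   ≡⟨ cong ((T₀ + T₁) +_) (+-comm T₁ T₂) ⟩
  (T₀ + T₁) + (T₂ + T₁)   ≡⟨ interchange T₀ T₁ T₂ T₁ ⟩
  (T₀ + T₂) + (T₁ + T₁)   ≡⟨ cong₂ _+_ T₀+T₂≡N T₁+T₁≡-N ⟩
  ℕtoℚ N + - ℕtoℚ N         ≡⟨ +-inverseʳ (ℕtoℚ N) ⟩
  0ℚ                      ∎
  where
  open ≡-Reasoning
  δ : ℕ → ℚ → ℕ → ℚ
  δ j c s = if s ≡ᵇ j then c else 0ℚ
  T₀ T₁ T₂ : ℚ
  T₀ = binomialSum (2 ℕ.+ t) (δ (2 ℕ.+ t) (ℕtoℚ ((3 ℕ.+ t) ℕ.* (2 ℕ.+ t))))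
  T₁ = binomialSum (2 ℕ.+ t) (δ (1 ℕ.+ t) (- ℕtoℚ (2 ℕ.+ t)))
  T₂ = binomialSum (2 ℕ.+ t) (δ t (ℕtoℚ 2))
  W₀ N : ℕ
  W₀ = (3 ℕ.+ t) ℕ.* (2 ℕ.+ t)
  N = (3 ℕ.+ t) ℕ.* (2 ℕ.+ t) ℕ.+ (2 ℕ.+ t) ℕ.* (1 ℕ.+ t)
  T₀+T₂≡N : T₀ + T₂ ≡ ℕtoℚ N
  T₀+T₂≡N = begin
    T₀ + T₂
      ≡⟨ cong₂ _+_ (binomialSum-indicator (2 ℕ.+ t) (2 ℕ.+ t) _) (binomialSum-indicator (2 ℕ.+ t) t _) ⟩
    ℕtoℚ (choose (2 ℕ.+ t) (2 ℕ.+ t)) * ℕtoℚ ((3 ℕ.+ t) ℕ.* (2 ℕ.+ t)) + ℕtoℚ (choose (2 ℕ.+ t) t) * ℕtoℚ 2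
      ≡⟨ cong₂ _+_ (trans (cong (λ c → ℕtoℚ c * ℕtoℚ W₀) (choose-diag (2 ℕ.+ t))) (*-identityˡ (ℕtoℚ W₀)))
                   (trans (sym (ℕtoℚ-* (choose (2 ℕ.+ t) t) 2)) (cong ℕtoℚ (choose-2 t))) ⟩
    ℕtoℚ ((3 ℕ.+ t) ℕ.* (2 ℕ.+ t)) + ℕtoℚ ((2 ℕ.+ t) ℕ.* (1 ℕ.+ t))
      ≡⟨ ℕtoℚ-+ W₀ ((2 ℕ.+ t) ℕ.* (1 ℕ.+ t)) ⟨
    ℕtoℚ N ∎
  T₁+T₁≡-N : T₁ + T₁ ≡ - ℕtoℚ N
  T₁+T₁≡-N = begin
    T₁ + T₁
      ≡⟨ cong (λ x → x + x) (binomialSum-indicator (2 ℕ.+ t) (1 ℕ.+ t) _) ⟩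
    ℕtoℚ (choose (2 ℕ.+ t) (1 ℕ.+ t)) * - ℕtoℚ (2 ℕ.+ t) + ℕtoℚ (choose (2 ℕ.+ t) (1 ℕ.+ t)) * - ℕtoℚ (2 ℕ.+ t)
      ≡⟨ cong (λ c → ℕtoℚ c * - ℕtoℚ (2 ℕ.+ t) + ℕtoℚ c * - ℕtoℚ (2 ℕ.+ t)) (choose-suc-diag (1 ℕ.+ t)) ⟩
    ℕtoℚ (2 ℕ.+ t) * - ℕtoℚ (2 ℕ.+ t) + ℕtoℚ (2 ℕ.+ t) * - ℕtoℚ (2 ℕ.+ t)
      ≡⟨ cong (λ x → x + x) (ℕtoℚ-*-neg (2 ℕ.+ t) (2 ℕ.+ t)) ⟩
    - ℕtoℚ M + - ℕtoℚ M
      ≡⟨ neg-distrib-+ (ℕtoℚ M) (ℕtoℚ M) ⟨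
    - (ℕtoℚ M + ℕtoℚ M)
      ≡⟨ cong -_ (sym (ℕtoℚ-+ M M)) ⟩
    - ℕtoℚ (M ℕ.+ M)
      ≡⟨ cong (λ k → - ℕtoℚ k) (2[2+t]²≡[3+t][2+t]+[2+t][1+t] t) ⟩
    - ℕtoℚ N ∎
    where
    M = (2 ℕ.+ t) ℕ.* (2 ℕ.+ t)

-- For an edge f ⊆ e ∪ A: U = ∣ f ∩ e ∣, V = ∣ f ─ e ∣, and P, Q count the points of e, of A outside f.
weightSum : ∀ t P Q U V → P ℕ.+ U ≡ 2 → Q ℕ.+ V ≡ 3 ℕ.+ t → U ℕ.+ V ≡ 2 →
  binomialSum₂ P Q (λ x s → cliqueWeight t (U ℕ.+ x) (2 ℕ.+ s))
    ≡ (if U ≡ᵇ 2 then ℕtoℚ ((3 ℕ.+ t) ℕ.* (2 ℕ.+ t)) else 0ℚ)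
weightSum t P Q 0 V P+U≡2 Q+V≡r U+V≡2
  rewrite U+V≡2
        | trans (sym (ℕP.+-identityʳ P)) P+U≡2
        | ℕP.+-cancelʳ-≡ 2 Q (1 ℕ.+ t) (trans Q+V≡r (ℕP.+-comm 2 (1 ℕ.+ t)))
  = weightSum-disjoint t
weightSum t P Q 1 V P+U≡2 Q+V≡r U+V≡2
  rewrite ℕP.suc-injective U+V≡2
        | ℕP.+-cancelʳ-≡ 1 P 1 P+U≡2
        | ℕP.+-cancelʳ-≡ 1 Q (2 ℕ.+ t) (trans Q+V≡r (ℕP.+-comm 1 (2 ℕ.+ t)))
  = weightSum-meeting t
weightSum t P Q 2 V P+U≡2 Q+V≡r U+V≡2
  rewrite ℕP.suc-injective (ℕP.suc-injective U+V≡2)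
        | ℕP.+-cancelʳ-≡ 2 P 0 P+U≡2
        | trans (sym (ℕP.+-identityʳ Q)) Q+V≡r
  = weightSum-equal t
weightSum t P Q (suc (suc (suc U))) V _ _ ()

choose*∣weight∣*rⁱ≤3*mⁱ*r[r-1] : ∀ t m i → i ℕ.≤ 2 →
  choose m i ℕ.* ∣weight∣ t i ℕ.* (3 ℕ.+ t) ℕ.^ i ℕ.≤ 3 ℕ.* m ℕ.^ i ℕ.* ((3 ℕ.+ t) ℕ.* (2 ℕ.+ t))
choose*∣weight∣*rⁱ≤3*mⁱ*r[r-1] t m 0 _ = begin
  1 ℕ.* ((2 ℕ.+ t) ℕ.* (1 ℕ.+ t)) ℕ.* 1  ≡⟨ solve (t L.∷ L.[]) ⟩
  (1 ℕ.+ t) ℕ.* (2 ℕ.+ t)                ≤⟨ ℕP.*-monoˡ-≤ (2 ℕ.+ t) (ℕP.+-monoˡ-≤ t (ℕP.m≤m+n 1 2)) ⟩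
  (3 ℕ.+ t) ℕ.* (2 ℕ.+ t)                ≤⟨ ℕP.m≤n*m _ 3 ⟩
  3 ℕ.* ((3 ℕ.+ t) ℕ.* (2 ℕ.+ t))        ∎
  where open ℕP.≤-Reasoning
choose*∣weight∣*rⁱ≤3*mⁱ*r[r-1] t m 1 _ = begin
  choose m 1 ℕ.* (1 ℕ.+ t) ℕ.* ((3 ℕ.+ t) ℕ.* 1)  ≡⟨ cong (λ c → c ℕ.* _ ℕ.* _) (choose-1 m) ⟩
  m ℕ.* (1 ℕ.+ t) ℕ.* ((3 ℕ.+ t) ℕ.* 1)           ≡⟨ solve (m L.∷ t L.∷ L.[]) ⟩
  m ℕ.* ((1 ℕ.+ t) ℕ.* (3 ℕ.+ t))                 ≤⟨ ℕP.*-monoʳ-≤ m (ℕP.*-monoˡ-≤ (3 ℕ.+ t) 1+t≤3[2+t]) ⟩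
  m ℕ.* (3 ℕ.* (2 ℕ.+ t) ℕ.* (3 ℕ.+ t))           ≡⟨ solve (m L.∷ t L.∷ L.[]) ⟩
  3 ℕ.* (m ℕ.* 1) ℕ.* ((3 ℕ.+ t) ℕ.* (2 ℕ.+ t))   ∎
  where
  open ℕP.≤-Reasoning
  1+t≤3[2+t] : 1 ℕ.+ t ℕ.≤ 3 ℕ.* (2 ℕ.+ t)
  1+t≤3[2+t] = ℕP.≤-trans (ℕP.m≤n+m (1 ℕ.+ t) (5 ℕ.+ t ℕ.+ t)) (ℕP.≤-reflexive (solve (t L.∷ L.[])))
choose*∣weight∣*rⁱ≤3*mⁱ*r[r-1] t m 2 _ = begin
  choose m 2 ℕ.* 2 ℕ.* ((3 ℕ.+ t) ℕ.* ((3 ℕ.+ t) ℕ.* 1))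
    ≡⟨ cong (λ k → choose m 2 ℕ.* 2 ℕ.* ((3 ℕ.+ t) ℕ.* k)) (ℕP.*-identityʳ (3 ℕ.+ t)) ⟩
  choose m 2 ℕ.* 2 ℕ.* ((3 ℕ.+ t) ℕ.* (3 ℕ.+ t))
    ≤⟨ ℕP.*-mono-≤ (choose-2*2≤m² m) (ℕP.*-monoˡ-≤ (3 ℕ.+ t) 3+t≤3[2+t]) ⟩
  m ℕ.* m ℕ.* (3 ℕ.* (2 ℕ.+ t) ℕ.* (3 ℕ.+ t))             ≡⟨ solve (m L.∷ t L.∷ L.[]) ⟩
  3 ℕ.* (m ℕ.* (m ℕ.* 1)) ℕ.* ((3 ℕ.+ t) ℕ.* (2 ℕ.+ t))   ∎
  where
  open ℕP.≤-Reasoning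
  3+t≤3[2+t] : 3 ℕ.+ t ℕ.≤ 3 ℕ.* (2 ℕ.+ t)
  3+t≤3[2+t] = ℕP.≤-trans (ℕP.m≤n+m (3 ℕ.+ t) (3 ℕ.+ t ℕ.+ t)) (ℕP.≤-reflexive (solve (t L.∷ L.[])))
choose*∣weight∣*rⁱ≤3*mⁱ*r[r-1] t m (suc (suc (suc i))) (ℕ.s≤s (ℕ.s≤s ()))

choose*∣weight∣*[rⁱ*k]≤6*nⁱ*[N*r[r-1]] : ∀ t m n i N k → m ℕ.≤ n → i ℕ.≤ 2 → k ℕ.≤ 2 ℕ.* N →
  choose m i ℕ.* ∣weight∣ t i ℕ.* ((3 ℕ.+ t) ℕ.^ i ℕ.* k) ℕ.≤ 6 ℕ.* n ℕ.^ i ℕ.* (N ℕ.* ((3 ℕ.+ t) ℕ.* (2 ℕ.+ t)))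
choose*∣weight∣*[rⁱ*k]≤6*nⁱ*[N*r[r-1]] t m n i N k m≤n i≤2 k≤2N = begin
  choose m i ℕ.* ∣weight∣ t i ℕ.* ((3 ℕ.+ t) ℕ.^ i ℕ.* k)
    ≡⟨ ℕP.*-assoc (choose m i ℕ.* ∣weight∣ t i) ((3 ℕ.+ t) ℕ.^ i) k ⟨
  choose m i ℕ.* ∣weight∣ t i ℕ.* (3 ℕ.+ t) ℕ.^ i ℕ.* k
    ≤⟨ ℕP.*-mono-≤ (choose*∣weight∣*rⁱ≤3*mⁱ*r[r-1] t m i i≤2) k≤2N ⟩
  3 ℕ.* m ℕ.^ i ℕ.* R ℕ.* (2 ℕ.* N)
    ≤⟨ ℕP.*-monoˡ-≤ (2 ℕ.* N) (ℕP.*-monoˡ-≤ R (ℕP.*-monoʳ-≤ 3 (ℕP.^-monoˡ-≤ i m≤n))) ⟩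
  3 ℕ.* n ℕ.^ i ℕ.* R ℕ.* (2 ℕ.* N)
    ≡⟨ 3ab[2c]≡6a[cb] (n ℕ.^ i) R N ⟩
  6 ℕ.* n ℕ.^ i ℕ.* (N ℕ.* R) ∎
  where
  open ℕP.≤-Reasoning
  R = (3 ℕ.+ t) ℕ.* (2 ℕ.+ t)
  3ab[2c]≡6a[cb] : ∀ a b c → 3 ℕ.* a ℕ.* b ℕ.* (2 ℕ.* c) ≡ 6 ℕ.* a ℕ.* (c ℕ.* b)
  3ab[2c]≡6a[cb] = solve-∀

-- The construction

module Construction (t : ℕ) {n : ℕ} (𝒜 : Subset n → Bool) where

  r : ℕ
  r = 3 ℕ.+ t

  good : Subset n → Subset n → Bool
  good = goodSetᵇ r 𝒜

  normaliser : Subset n → ℕ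
  normaliser e = count (good e) ℕ.* (r ℕ.* (2 ℕ.+ t))

  weightIn : Subset n → Subset n → Subset n → ℚ
  weightIn e A K = if K ⊑ (e ∪ A) then cliqueWeight t ∣ K ∩ e ∣ˢ ∣ K ∣ˢ else 0ℚ

  totalWeight : Subset n → Subset n → ℚ
  totalWeight e K = ∑ˢ (λ A → if good e A then weightIn e A K else 0ℚ)

  ψ : Subset n → Subset n → ℚ
  ψ e K = totalWeight e K * invℕ (normaliser e)

  good⇒⊑∁ : ∀ e A → good e A ≡ true → A ⊑ ∁ e ≡ true
  good⇒⊑∁ e A isGood = trans (sym (⊆ᵇ≡⊑ A (∁ e))) (∧-conicalˡ _ _ isGood)

  good⇒∣∣≡ᵇr : ∀ e A → good e A ≡ true → (∣ A ∣ˢ ≡ᵇ r) ≡ true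
  good⇒∣∣≡ᵇr e A isGood = ∧-conicalˡ _ _ (∧-conicalʳ (A ⊆ᵇ ∁ e) _ isGood)

  good⇒∈𝒜 : ∀ e A → good e A ≡ true → ∀ K → K ⊑ (e ∪ A) ≡ true → (∣ K ∣ˢ ≡ᵇ r) ≡ true → 𝒜 K ≡ true
  good⇒∈𝒜 e A isGood K K⊑e∪A ∣K∣≡ᵇr =
    subst₂ (λ b c → (not (b ∧ c) ∨ 𝒜 K) ≡ true) (trans (⊆ᵇ≡⊑ K (e ∪ A)) K⊑e∪A) ∣K∣≡ᵇr
      (allᵇ-∈ _ (∧-conicalʳ (∣ A ∣ˢ ≡ᵇ r) _ (∧-conicalʳ (A ⊆ᵇ ∁ e) _ isGood)) (∈-allSubsets K))

  weightIn-sum : ∀ e f A → ∣ e ∣ˢ ≡ 2 → ∣ f ∣ˢ ≡ 2 → good e A ≡ true →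
    ∑ˢ (λ K → if 𝒜 K ∧ (f ⊆ᵇ K) then weightIn e A K else 0ℚ) ≡
    (if f ⊑ (e ∪ A) then (if ∣ f ∩ e ∣ˢ ≡ᵇ 2 then ℕtoℚ (r ℕ.* (2 ℕ.+ t)) else 0ℚ) else 0ℚ)
  weightIn-sum e f A ∣e∣≡2 ∣f∣≡2 isGood = begin
    ∑ˢ (λ K → if 𝒜 K ∧ (f ⊆ᵇ K) then weightIn e A K else 0ℚ)
      ≡⟨ ∑ˢ-cong (λ K → trans (cong (λ b → if 𝒜 K ∧ b then weightIn e A K else 0ℚ) (⊆ᵇ≡⊑ f K))
           (if-∧-implied (𝒜 K) (f ⊑ K) (K ⊑ W) (∣ K ∣ˢ ≡ᵇ r) _ (good⇒∈𝒜 e A isGood K))) ⟩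
    intervalSum e f W (cliqueWeight t)
      ≡⟨ intervalSum≡binomialSum₂ e f W (cliqueWeight t) ⟩
    (if f ⊑ W then binomialSum₂ P Q (λ x s → cliqueWeight t (U ℕ.+ x) (∣ f ∣ˢ ℕ.+ s)) else 0ℚ)
      ≡⟨ if-cong (f ⊑ W) (λ f⊑W → trans
           (cong (λ m → binomialSum₂ P Q (λ x s → cliqueWeight t (U ℕ.+ x) (m ℕ.+ s))) ∣f∣≡2)
           (weightSum t P Q U V (trans (∣p∩[p∪q]─r∣+∣r∩p∣≡∣p∣ e A f) ∣e∣≡2)
             (trans (∣[p∪q]─r─p∣+∣r─p∣≡∣q∣ e A f (good⇒⊑∁ e A isGood) f⊑W) ∣A∣≡r)
             (trans (∣p∩q∣+∣p─q∣≡∣p∣ f e) ∣f∣≡2))) ⟩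
    (if f ⊑ W then (if U ≡ᵇ 2 then ℕtoℚ (r ℕ.* (2 ℕ.+ t)) else 0ℚ) else 0ℚ) ∎
    where
    open ≡-Reasoning
    W = e ∪ A
    P = ∣ e ∩ (W ─ f) ∣ˢ
    Q = ∣ W ─ f ─ e ∣ˢ
    U = ∣ f ∩ e ∣ˢ
    V = ∣ f ─ e ∣ˢ
    ∣A∣≡r : ∣ A ∣ˢ ≡ r
    ∣A∣≡r = ℕP.≡ᵇ⇒≡ ∣ A ∣ˢ r (Equivalence.from T-≡ (good⇒∣∣≡ᵇr e A isGood))

  sumOverEdgeCliques-ψ : ∀ e f V →
    (∀ A → good e A ≡ true → ∑ˢ (λ K → if 𝒜 K ∧ (f ⊆ᵇ K) then weightIn e A K else 0ℚ) ≡ V) →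
    sumOverEdgeCliques 𝒜 f (ψ e) ≡ ℕtoℚ (count (good e)) * V * invℕ (normaliser e)
  sumOverEdgeCliques-ψ e f V inner≡V = begin
    sumOverEdgeCliques 𝒜 f (ψ e)
      ≡⟨ foldr-filterᵇ≡sumℚ fCliques (ψ e) (allSubsets n) ⟩
    ∑ˢ (λ K → if fCliques K then totalWeight e K * c else 0ℚ)
      ≡⟨ ∑ˢ-cong (λ K → if-* (fCliques K) (totalWeight e K) c) ⟩
    ∑ˢ (λ K → (if fCliques K then totalWeight e K else 0ℚ) * c)
      ≡⟨ sumℚ-*ʳ (λ K → if fCliques K then totalWeight e K else 0ℚ) c (allSubsets n) ⟩
    ∑ˢ (λ K → if fCliques K then totalWeight e K else 0ℚ) * c
      ≡⟨ cong (_* c) (∑ˢ-double-count fCliques (good e) (weightIn e) V inner≡V) ⟩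
    ℕtoℚ (count (good e)) * V * c ∎
    where
    open ≡-Reasoning
    fCliques : Subset n → Bool
    fCliques K = 𝒜 K ∧ (f ⊆ᵇ K)
    c = invℕ (normaliser e)

  sumOverEdgeCliques-ψ-refl : ∀ e → ∣ e ∣ˢ ≡ 2 → .{{ℕ.NonZero (count (good e))}} →
    sumOverEdgeCliques 𝒜 e (ψ e) ≡ 1ℚ
  sumOverEdgeCliques-ψ-refl e ∣e∣≡2 = begin
    sumOverEdgeCliques 𝒜 e (ψ e)
      ≡⟨ sumOverEdgeCliques-ψ e e (ℕtoℚ R) (λ A isGood → trans (weightIn-sum e e A ∣e∣≡2 ∣e∣≡2 isGood)
           (trans (if-true (⊑∪ e A)) (if-true (cong (_≡ᵇ 2) (trans (cong ∣_∣ˢ (∩-idem e)) ∣e∣≡2))))) ⟩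
    ℕtoℚ N * ℕtoℚ R * invℕ (N ℕ.* R)
      ≡⟨ cong (_* invℕ (N ℕ.* R)) (ℕtoℚ-* N R) ⟨
    ℕtoℚ (N ℕ.* R) * invℕ (N ℕ.* R)
      ≡⟨ ℕtoℚ*invℕ (N ℕ.* R) {{ℕP.m*n≢0 N R}} ⟩
    1ℚ ∎
    where
    open ≡-Reasoning
    N = count (good e)
    R = r ℕ.* (2 ℕ.+ t)

  sumOverEdgeCliques-ψ-≢ : ∀ e f → ∣ e ∣ˢ ≡ 2 → ∣ f ∣ˢ ≡ 2 → e ≢ f →
    sumOverEdgeCliques 𝒜 f (ψ e) ≡ 0ℚ
  sumOverEdgeCliques-ψ-≢ e f ∣e∣≡2 ∣f∣≡2 e≢f = begin
    sumOverEdgeCliques 𝒜 f (ψ e)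
      ≡⟨ sumOverEdgeCliques-ψ e f 0ℚ (λ A isGood → trans (weightIn-sum e f A ∣e∣≡2 ∣f∣≡2 isGood)
           (trans (if-cong (f ⊑ (e ∪ A)) (λ _ → if-false ∣f∩e∣≢ᵇ2)) (if-same (f ⊑ (e ∪ A))))) ⟩
    ℕtoℚ (count (good e)) * 0ℚ * invℕ (normaliser e)
      ≡⟨ cong (_* invℕ (normaliser e)) (*-zeroʳ (ℕtoℚ (count (good e)))) ⟩
    0ℚ * invℕ (normaliser e)
      ≡⟨ *-zeroˡ (invℕ (normaliser e)) ⟩
    0ℚ ∎
    where
    open ≡-Reasoning
    ∣f∩e∣≢ᵇ2 : (∣ f ∩ e ∣ˢ ≡ᵇ 2) ≡ false
    ∣f∩e∣≢ᵇ2 with ∣ f ∩ e ∣ˢ ≡ᵇ 2 in eq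
    ... | false = refl
    ... | true  =
      ⊥-elim (e≢f (sym (∣p∩q∣≡∣p∣≡∣q∣⇒p≡q f e (trans U≡2 (sym ∣f∣≡2)) (trans U≡2 (sym ∣e∣≡2)))))
      where U≡2 = ℕP.≡ᵇ⇒≡ ∣ f ∩ e ∣ˢ 2 (Equivalence.from T-≡ eq)

  ∣totalWeight∣≤ : ∀ e K → ∣ K ∣ˢ ≡ r →
    abs (totalWeight e K) ≤ ℕtoℚ (choose ∣ ⊤ ─ (K ─ e) ∣ˢ ∣ K ∩ e ∣ˢ) * abs (weight t ∣ K ∩ e ∣ˢ)
  ∣totalWeight∣≤ e K ∣K∣≡r = begin
    abs (totalWeight e K)
      ≤⟨ ∣sumℚ∣≤sumℚ∣∣ (λ A → if good e A then weightIn e A K else 0ℚ) (allSubsets n) ⟩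
    ∑ˢ (λ A → abs (if good e A then weightIn e A K else 0ℚ))
      ≤⟨ sumℚ-mono-≤ (allSubsets n) (λ A → subst (λ b → abs (if good e A then weightIn e A K else 0ℚ)
                                                       ≤ (if b then h ∣ A ∣ˢ else 0ℚ))
           (⊑∪≡─⊑ K e A)
           (∣if∣≤if∣∣ (good e A) (K ⊑ (e ∪ A)) (∣ K ∣ˢ ≡ᵇ r) (∣ A ∣ˢ ≡ᵇ r) (weight t i) (good⇒∣∣≡ᵇr e A))) ⟩
    ∑ˢ (λ A → if (K ─ e) ⊑ A then h ∣ A ∣ˢ else 0ℚ)
      ≡⟨ ∑ˢ-supersets (K ─ e) h ⟩
    binomialSum Q (λ s → h (∣ K ─ e ∣ˢ ℕ.+ s))
      ≡⟨ binomialSum-cong Q (λ s → cong (λ b → if b then a else 0ℚ)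
           (trans (cong (∣ K ─ e ∣ˢ ℕ.+ s ≡ᵇ_) r≡∣K─e∣+i) (+-≡ᵇ-cancelˡ ∣ K ─ e ∣ˢ s i))) ⟩
    binomialSum Q (λ s → if s ≡ᵇ i then a else 0ℚ)
      ≡⟨ binomialSum-indicator Q i a ⟩
    ℕtoℚ (choose Q i) * a ∎
    where
    open ≤-Reasoning
    i = ∣ K ∩ e ∣ˢ
    Q = ∣ ⊤ ─ (K ─ e) ∣ˢ
    a = abs (weight t i)
    h : ℕ → ℚ
    h s = if s ≡ᵇ r then a else 0ℚ
    r≡∣K─e∣+i : r ≡ ∣ K ─ e ∣ˢ ℕ.+ i
    r≡∣K─e∣+i = trans (sym ∣K∣≡r) (sym (∣p─q∣+∣p∩q∣≡∣p∣ K e))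

  ψ-bound : ∀ e K k → ∣ e ∣ˢ ≡ 2 → ∣ K ∣ˢ ≡ r → k ℕ.≤ 2 ℕ.* count (good e) → .{{ℕ.NonZero (count (good e))}} →
    abs (ψ e K) * ℕtoℚ (r ℕ.^ ∣ K ∩ e ∣ˢ ℕ.* k) ≤ ℕtoℚ (6 ℕ.* n ℕ.^ ∣ K ∩ e ∣ˢ)
  ψ-bound e K k ∣e∣≡2 ∣K∣≡r k≤2N = begin
    abs (totalWeight e K * c) * ℕtoℚ Y
      ≡⟨ cong (_* ℕtoℚ Y) (trans (∣p*q∣≡∣p∣*∣q∣ (totalWeight e K) c)
                                 (cong (abs (totalWeight e K) *_) (0≤p⇒∣p∣≡p 0≤c))) ⟩
    abs (totalWeight e K) * c * ℕtoℚ Y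
      ≤⟨ *-monoʳ-≤-nonNeg (ℕtoℚ Y) {{nonNegative (0≤ℕtoℚ Y)}}
           (*-monoʳ-≤-nonNeg c {{nonNegative 0≤c}} (∣totalWeight∣≤ e K ∣K∣≡r)) ⟩
    ℕtoℚ (choose Q i) * abs (weight t i) * c * ℕtoℚ Y
      ≡⟨ cong (λ x → x * c * ℕtoℚ Y)
           (trans (cong (ℕtoℚ (choose Q i) *_) (abs-weight t i)) (sym (ℕtoℚ-* (choose Q i) _))) ⟩
    ℕtoℚ X * c * ℕtoℚ Y
      ≡⟨ trans (xy∙z≈xz∙y (ℕtoℚ X) c (ℕtoℚ Y)) (cong (_* c) (sym (ℕtoℚ-* X Y))) ⟩
    ℕtoℚ (X ℕ.* Y) * c
      ≤⟨ *-monoʳ-≤-nonNeg c {{nonNegative 0≤c}} (ℕtoℚ-mono-≤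
           (choose*∣weight∣*[rⁱ*k]≤6*nⁱ*[N*r[r-1]] t Q n i (count (good e)) k (∣p∣≤n (⊤ ─ (K ─ e))) i≤2 k≤2N)) ⟩
    ℕtoℚ (M ℕ.* D) * c
      ≡⟨ trans (cong (_* c) (ℕtoℚ-* M D)) (*-assoc (ℕtoℚ M) (ℕtoℚ D) c) ⟩
    ℕtoℚ M * (ℕtoℚ D * c)
      ≡⟨ cong (ℕtoℚ M *_) (ℕtoℚ*invℕ D {{ℕP.m*n≢0 (count (good e)) (r ℕ.* (2 ℕ.+ t))}}) ⟩
    ℕtoℚ M * 1ℚ
      ≡⟨ *-identityʳ (ℕtoℚ M) ⟩
    ℕtoℚ M ∎
    where
    open ≤-Reasoning
    i = ∣ K ∩ e ∣ˢ
    Q = ∣ ⊤ ─ (K ─ e) ∣ˢ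
    c = invℕ (normaliser e)
    X = choose Q i ℕ.* ∣weight∣ t i
    Y = r ℕ.^ i ℕ.* k
    M = 6 ℕ.* n ℕ.^ i
    D = normaliser e
    0≤c : 0ℚ ≤ c
    0≤c = 0≤invℕ D
    i≤2 : i ℕ.≤ 2
    i≤2 = subst (i ℕ.≤_) ∣e∣≡2 (∣p∩q∣≤∣q∣ K e)

isKrᵇ⇒∣∣≡ : ∀ {n} (G : Graph n) r S → isKrᵇ G r S ≡ true → ∣ S ∣ˢ ≡ r
isKrᵇ⇒∣∣≡ G r S isKr = ℕP.≡ᵇ⇒≡ ∣ S ∣ˢ r (Equivalence.from T-≡ (∧-conicalʳ (isCliqueᵇ G S) _ isKr))

0<k≤2N⇒N≢0 : ∀ {k} N → 0 ℕ.< k → k ℕ.≤ 2 ℕ.* N → ℕ.NonZero N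
0<k≤2N⇒N≢0 zero    0<k k≤0 = ⊥-elim (ℕP.<-irrefl refl (ℕP.<-≤-trans 0<k k≤0))
0<k≤2N⇒N≢0 (suc N) _   _   = _

lemma5p2 : (r n : ℕ) → r ℕ.≥ 3 → (G : Graph n) → kr G r ℕ.> 0 →
    (𝒜 : Subset n → Bool) → SubFamily G r 𝒜 → WellDistributed G r 𝒜 →
    Σ (Subset n → Subset n → ℚ) λ ψ →
      (∀ e f → IsEdge G e → IsEdge G f →
        (e ≡ f → sumOverEdgeCliques 𝒜 f (ψ e) ≡ 1ℚ) ×
        (e ≢ f → sumOverEdgeCliques 𝒜 f (ψ e) ≡ 0ℚ)) ×
      (∀ K e → 𝒜 K ≡ true → IsEdge G e →
        abs (ψ e K) * ℕtoℚ (r ℕ.^ ∣ K ∩ e ∣ˢ ℕ.* kr G r) ≤ ℕtoℚ (6 ℕ.* n ℕ.^ ∣ K ∩ e ∣ˢ))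
lemma5p2 .(3 ℕ.+ t) n (ℕ.s≤s (ℕ.s≤s (ℕ.s≤s (ℕ.z≤n {t})))) G kr>0 𝒜 𝒜⊆𝒦 wellDistributed = ψ
  , (λ e f e∈E f∈E → (λ { refl → sumOverEdgeCliques-ψ-refl e (∣e∣≡2 e∈E) {{N≢0 e∈E}} })
                    , sumOverEdgeCliques-ψ-≢ e f (∣e∣≡2 e∈E) (∣e∣≡2 f∈E))
  , (λ K e K∈𝒜 e∈E →
      ψ-bound e K (kr G r) (∣e∣≡2 e∈E) (isKrᵇ⇒∣∣≡ G r K (𝒜⊆𝒦 K K∈𝒜)) (wellDistributed e e∈E) {{N≢0 e∈E}})
  where
  open Construction t 𝒜
  ∣e∣≡2 : ∀ {e} → IsEdge G e → ∣ e ∣ˢ ≡ 2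
  ∣e∣≡2 {e} = isKrᵇ⇒∣∣≡ G 2 e
  N≢0 : ∀ {e} → IsEdge G e → ℕ.NonZero (count (good e))
  N≢0 {e} e∈E = 0<k≤2N⇒N≢0 (count (good e)) kr>0 (wellDistributed e e∈E)
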